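{- If a finite simple graph $G$ is cobipartite, then $Z_+(G)=Z(G)$.
   Context: A graph is cobipartite if its vertex set can be partitioned into two cliques. $Z(G)$ is the zero forcing number: the smallest size of an initially filled set from which repeatedly applying the rule "a filled vertex $v$ whose only unfilled neighbor is $u$ forces $u$ to become filled" fills all vertices. Positive semidefinite zero forcing rule: consider the subgraph obtained by deleting all filled vertices; if a filled vertex $v$ has exactly one neighbor $u$ in some connected component of that subgraph, then $v$ may force $u$ to become filled. $Z_+(G)$ is the smallest size of an initially filled set from which repeated application of this rule fills all vertices. -}

module Defs where

open import Data.Nat using (ℕ; _≤_)
open import Data.Bool using (Bool; true; false)
open import Data.Fin using (Fin)
open import Data.Fin.Subset using (Subset; _∈_; _∉_; ∣_∣; _∪_; ⁅_⁆)
open import Data.Product using (Σ; _×_; ∃-syntax)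
open import Relation.Binary.PropositionalEquality using (_≡_; _≢_)

record Graph (n : ℕ) : Set where
  field
    adj   : Fin n → Fin n → Bool
    sym   : ∀ x y → adj x y ≡ adj y x
    irrefl : ∀ x → adj x x ≡ false

open Graph public

Adj : ∀ {n} → Graph n → Fin n → Fin n → Set
Adj G x y = adj G x y ≡ true

Cobipartite : ∀ {n} → Graph n → Set
Cobipartite {n} G = Σ (Subset n) λ P →
    (∀ x y → x ∈ P → y ∈ P → x ≢ y → Adj G x y)
  × (∀ x y → x ∉ P → y ∉ P → x ≢ y → Adj G x y)

ZFStep : ∀ {n} → Graph n → Subset n → Fin n → Set
ZFStep G S u = ∃[ v ] (v ∈ S × u ∉ S × Adj G v u ×
                       (∀ w → Adj G v w → w ∉ S → w ≡ u))

-- Paths in the subgraph G − S (all vertices on the path are unfilled):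
-- SameComp G S x y means x and y lie in the same connected component of G − S.
data SameComp {n} (G : Graph n) (S : Subset n) : Fin n → Fin n → Set where
  here : ∀ {x} → x ∉ S → SameComp G S x x
  step : ∀ {x z y} → x ∉ S → Adj G x z → SameComp G S z y → SameComp G S x y

PSDStep : ∀ {n} → Graph n → Subset n → Fin n → Set
PSDStep G S u = ∃[ v ] (v ∈ S × u ∉ S × Adj G v u ×
                        (∀ w → Adj G v w → SameComp G S u w → w ≡ u))

data Fills {n} (Rule : Subset n → Fin n → Set) : Subset n → Set where
  done  : ∀ {S} → (∀ x → x ∈ S) → Fills Rule S
  force : ∀ {S} u → Rule S u → Fills Rule (S ∪ ⁅ u ⁆) → Fills Rule S

IsMinFilling : ∀ {n} → (Subset n → Fin n → Set) → ℕ → Set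
IsMinFilling {n} Rule k =
    (∃[ S ] (Fills Rule S × ∣ S ∣ ≡ k))
  × (∀ S → Fills Rule S → k ≤ ∣ S ∣)

IsZ : ∀ {n} → Graph n → ℕ → Set
IsZ G = IsMinFilling (ZFStep G)

IsZ₊ : ∀ {n} → Graph n → ℕ → Set
IsZ₊ G = IsMinFilling (PSDStep G)

{-# OPTIONS --safe #-}
-- Every zero forcing step is a PSD forcing step, so Z₊ ≤ Z.  Conversely, let
-- S be a PSD forcing set of G, whose vertices split into cliques P and Q.  If
-- an edge joins an unfilled vertex of P to an unfilled vertex of Q, then G − S
-- is connected and stays connected while forcing, so every PSD force is an
-- ordinary force and S itself is a zero forcing set.  Otherwise start from the
-- zero forcing set S ∪ P and follow the PSD forcing process: when v forces a
-- vertex u of P, the current set contains the closed neighbourhood of u, so v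
-- can be dropped from it (u forces v back).  Each of the ∣P ─ S∣ forces into P
-- drops one vertex, which leaves a zero forcing set of size at most ∣S∣.
module Submission where

open import Defs
open import Data.Bool using (true; false)
import Data.Bool as Bool
open import Data.Empty using (⊥-elim)
open import Data.Fin using (Fin) renaming (_≟_ to _≟ᶠ_)
open import Data.Fin.Properties using (any?)
open import Data.Fin.Subset using (Subset; _∈_; _∉_; _⊆_; ∣_∣; _∪_; _─_; _-_; ⁅_⁆; ⊤; ⊥)
open import Data.Fin.Subset.Properties
open import Data.Nat using (ℕ; suc; _+_; _≤_; s≤s)
open import Data.Nat.Properties
  using (≤-refl; ≤-trans; ≤-antisym; ≤-reflexive; +-monoʳ-≤; +-cancelʳ-≤; +-suc; +-identityʳ; n≤1+n; module ≤-Reasoning)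
open import Data.Product using (_×_; _,_; ∃-syntax)
open import Data.Sum using (inj₁; inj₂)
import Data.Unit as Unit
open import Data.Vec using (_∷_; []; here; there)
open import Function using (_∘_)
open import Relation.Nullary using (¬_; Dec; yes; no)
open import Relation.Nullary.Decidable using (_×-dec_; ¬?)
open import Relation.Binary.PropositionalEquality
  using (_≡_; _≢_; refl; trans; cong; subst; ≢-sym; module ≡-Reasoning)
  renaming (sym to ≡-sym)

∣p∪q∣≤∣p∣+∣q∣ : ∀ {n} (p q : Subset n) → ∣ p ∪ q ∣ ≤ ∣ p ∣ + ∣ q ∣
∣p∪q∣≤∣p∣+∣q∣ []          []          = ≤-refl
∣p∪q∣≤∣p∣+∣q∣ (true ∷ p)  (true ∷ q)  =
  s≤s (≤-trans (∣p∪q∣≤∣p∣+∣q∣ p q) (+-monoʳ-≤ ∣ p ∣ (n≤1+n ∣ q ∣)))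
∣p∪q∣≤∣p∣+∣q∣ (true ∷ p)  (false ∷ q) = s≤s (∣p∪q∣≤∣p∣+∣q∣ p q)
∣p∪q∣≤∣p∣+∣q∣ (false ∷ p) (true ∷ q)  =
  ≤-trans (s≤s (∣p∪q∣≤∣p∣+∣q∣ p q)) (≤-reflexive (≡-sym (+-suc ∣ p ∣ ∣ q ∣)))
∣p∪q∣≤∣p∣+∣q∣ (false ∷ p) (false ∷ q) = ∣p∪q∣≤∣p∣+∣q∣ p q

x∈p─q⇒x∉q : ∀ {n} {x : Fin n} (p q : Subset n) → x ∈ p ─ q → x ∉ q
x∈p─q⇒x∉q (_ ∷ p) (true ∷ q)  ()         here
x∈p─q⇒x∉q (_ ∷ p) (false ∷ q) here       ()
x∈p─q⇒x∉q (_ ∷ p) (_ ∷ q)     (there x∈) (there x∈q) = x∈p─q⇒x∉q p q x∈ x∈q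

module _ {n : ℕ} where

  x∈p∪⁅x⁆ : (p : Subset n) (x : Fin n) → x ∈ p ∪ ⁅ x ⁆
  x∈p∪⁅x⁆ p x = q⊆p∪q p ⁅ x ⁆ (x∈⁅x⁆ x)

  x∉p∪q⇒x∉p : ∀ {x : Fin n} {p : Subset n} (q : Subset n) → x ∉ p ∪ q → x ∉ p
  x∉p∪q⇒x∉p q x∉p∪q = x∉p∪q ∘ p⊆p∪q q

  x∉p∧x≢y⇒x∉p∪⁅y⁆ : ∀ {x y : Fin n} {p : Subset n} → x ∉ p → x ≢ y → x ∉ p ∪ ⁅ y ⁆
  x∉p∧x≢y⇒x∉p∪⁅y⁆ {p = p} x∉p x≢y x∈ with x∈p∪q⁻ p _ x∈
  ... | inj₁ x∈p = x∉p x∈p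
  ... | inj₂ x∈⁅y⁆ = x≢y (x∈⁅y⁆⇒x≡y _ x∈⁅y⁆)

  ∪-⊆ : ∀ {p q r : Subset n} → p ⊆ r → q ⊆ r → p ∪ q ⊆ r
  ∪-⊆ {p} {q} p⊆r q⊆r x∈ with x∈p∪q⁻ p q x∈
  ... | inj₁ x∈p = p⊆r x∈p
  ... | inj₂ x∈q = q⊆r x∈q

  ∪-monoˡ-⊆ : ∀ {p q : Subset n} (r : Subset n) → p ⊆ q → p ∪ r ⊆ q ∪ r
  ∪-monoˡ-⊆ {q = q} r p⊆q = ∪-⊆ (p⊆p∪q r ∘ p⊆q) (q⊆p∪q q r)

  x∈p⇒⁅x⁆⊆p : ∀ {x : Fin n} {p : Subset n} → x ∈ p → ⁅ x ⁆ ⊆ p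
  x∈p⇒⁅x⁆⊆p {p = p} x∈p y∈⁅x⁆ = subst (_∈ p) (≡-sym (x∈⁅y⁆⇒x≡y _ y∈⁅x⁆)) x∈p

  p⊆⁅x⁆∪p-x : (p : Subset n) (x : Fin n) → p ⊆ ⁅ x ⁆ ∪ (p - x)
  p⊆⁅x⁆∪p-x p x {y} y∈p with y ≟ᶠ x
  ... | yes refl = p⊆p∪q (p - x) (x∈⁅x⁆ y)
  ... | no y≢x   = q⊆p∪q ⁅ x ⁆ (p - x) (x∈p∧x≢y⇒x∈p-y y∈p y≢x)

  p∪q⊆p∪q─p : (p q : Subset n) → p ∪ q ⊆ p ∪ (q ─ p)
  p∪q⊆p∪q─p p q {x} x∈ with x ∈? p | x∈p∪q⁻ p q x∈
  ... | yes x∈p | _       = p⊆p∪q (q ─ p) x∈p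
  ... | no x∉p  | inj₁ x∈p = ⊥-elim (x∉p x∈p)
  ... | no x∉p  | inj₂ x∈q = q⊆p∪q p (q ─ p) (x∈p∧x∉q⇒x∈p─q x∈q x∉p)

  p─q⊆p─q∪⁅x⁆ : ∀ {x : Fin n} {p : Subset n} (q : Subset n) → x ∉ p → p ─ q ⊆ p ─ (q ∪ ⁅ x ⁆)
  p─q⊆p─q∪⁅x⁆ {p = p} q x∉p y∈ =
    x∈p∧x∉q⇒x∈p─q y∈p (x∉p∧x≢y⇒x∉p∪⁅y⁆ (x∈p─q⇒x∉q p q y∈) λ { refl → x∉p y∈p })
    where y∈p = p─q⊆p p q y∈

  p⊆q∪r⇒∣p∣≤∣q∣+∣r∣ : ∀ {p q r : Subset n} → p ⊆ q ∪ r → ∣ p ∣ ≤ ∣ q ∣ + ∣ r ∣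
  p⊆q∪r⇒∣p∣≤∣q∣+∣r∣ {q = q} {r} p⊆q∪r = ≤-trans (p⊆q⇒∣p∣≤∣q∣ p⊆q∪r) (∣p∪q∣≤∣p∣+∣q∣ q r)

  ∣p∣≤1+∣p-x∣ : (p : Subset n) (x : Fin n) → ∣ p ∣ ≤ suc ∣ p - x ∣
  ∣p∣≤1+∣p-x∣ p x =
    subst (λ k → ∣ p ∣ ≤ k + ∣ p - x ∣) (∣⁅x⁆∣≡1 x) (p⊆q∪r⇒∣p∣≤∣q∣+∣r∣ (p⊆⁅x⁆∪p-x p x))

  ∣p─q∣≤1+∣p─q∪⁅x⁆∣ : (p q : Subset n) (x : Fin n) → ∣ p ─ q ∣ ≤ suc ∣ p ─ (q ∪ ⁅ x ⁆) ∣
  ∣p─q∣≤1+∣p─q∪⁅x⁆∣ p q x =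
    subst (λ r → ∣ p ─ q ∣ ≤ suc ∣ r ∣) (p─q─r≡p─q∪r p q ⁅ x ⁆) (∣p∣≤1+∣p-x∣ (p ─ q) x)

  ∣p∪q∣≤∣p∣+∣q─p∣ : (p q : Subset n) → ∣ p ∪ q ∣ ≤ ∣ p ∣ + ∣ q ─ p ∣
  ∣p∪q∣≤∣p∣+∣q─p∣ p q = p⊆q∪r⇒∣p∣≤∣q∣+∣r∣ (p∪q⊆p∪q─p p q)

  ∀x∈q⇒∣p─q∣≡0 : (p q : Subset n) → (∀ x → x ∈ q) → ∣ p ─ q ∣ ≡ 0
  ∀x∈q⇒∣p─q∣≡0 p q all = begin
    ∣ p ─ q ∣     ≡⟨ cong (λ r → ∣ p ─ r ∣) (⊆-antisym ⊆⊤ (λ {x} _ → all x)) ⟩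
    ∣ p ─ ⊤ ∣     ≡⟨ cong ∣_∣ (p─⊤≡⊥ p) ⟩
    ∣ ⊥ {n = n} ∣ ≡⟨ ∣⊥∣≡0 n ⟩
    0             ∎
    where open ≡-Reasoning

module _ {n : ℕ} {Rule : Subset n → Fin n → Set} where

  fills-mono : (∀ {X Y u} → X ⊆ Y → u ∉ Y → Rule X u → Rule Y u) →
               ∀ {X Y} → X ⊆ Y → Fills Rule X → Fills Rule Y
  fills-mono _    X⊆Y (done all) = done (λ x → X⊆Y (all x))
  fills-mono mono {Y = Y} X⊆Y (force u r rest) with u ∈? Y
  ... | yes u∈Y = fills-mono mono (∪-⊆ X⊆Y (x∈p⇒⁅x⁆⊆p u∈Y)) rest
  ... | no u∉Y  = force u (mono X⊆Y u∉Y r) (fills-mono mono (∪-monoˡ-⊆ ⁅ u ⁆ X⊆Y) rest)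

  fills-transfer : {Rule′ : Subset n → Fin n → Set} (Inv : Subset n → Set) →
                   (∀ {S u} → Inv S → Rule S u → Rule′ S u) →
                   (∀ {S u} → Inv S → Rule′ S u → Inv (S ∪ ⁅ u ⁆)) →
                   ∀ {S} → Inv S → Fills Rule S → Fills Rule′ S
  fills-transfer _   _       _        _   (done all)       = done all
  fills-transfer Inv convert preserve inv (force u r rest) =
    force u r′ (fills-transfer Inv convert preserve (preserve inv r′) rest)
    where r′ = convert inv r

module _ {n : ℕ} (G : Graph n) where

  adj-sym : ∀ {x y} → Adj G x y → Adj G y x
  adj-sym {x} {y} xy = trans (Graph.sym G y x) xy

  adj⇒≢ : ∀ {x y} → Adj G x y → x ≢ y
  adj⇒≢ {x} xx refl with trans (≡-sym xx) (Graph.irrefl G x)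
  ... | ()

  IsClique : (Fin n → Set) → Set
  IsClique C = ∀ x y → C x → C y → x ≢ y → Adj G x y

  sameComp⇒∉ : ∀ {S x y} → SameComp G S x y → y ∉ S
  sameComp⇒∉ (here y∉S)     = y∉S
  sameComp⇒∉ (step _ _ rest) = sameComp⇒∉ rest

  sameComp-trans : ∀ {S x y z} → SameComp G S x y → SameComp G S y z → SameComp G S x z
  sameComp-trans (here _)          yz = yz
  sameComp-trans (step x∉S xw wy) yz = step x∉S xw (sameComp-trans wy yz)

  sameComp-antitone : ∀ {X Y x y} → X ⊆ Y → SameComp G Y x y → SameComp G X x y
  sameComp-antitone X⊆Y (here y∉Y)        = here (y∉Y ∘ X⊆Y)
  sameComp-antitone X⊆Y (step x∉Y xw wy) = step (x∉Y ∘ X⊆Y) xw (sameComp-antitone X⊆Y wy)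

  clique-sameComp : ∀ {C S x y} → IsClique C → C x → C y → x ∉ S → y ∉ S → SameComp G S x y
  clique-sameComp {x = x} {y} clique Cx Cy x∉S y∉S with x ≟ᶠ y
  ... | yes refl = here x∉S
  ... | no x≢y   = step x∉S (clique x y Cx Cy x≢y) (here y∉S)

  zfStep-mono : ∀ {X Y u} → X ⊆ Y → u ∉ Y → ZFStep G X u → ZFStep G Y u
  zfStep-mono X⊆Y u∉Y (v , v∈X , _ , vu , only) =
    v , X⊆Y v∈X , u∉Y , vu , λ w vw w∉Y → only w vw (w∉Y ∘ X⊆Y)

  psdStep-mono : ∀ {X Y u} → X ⊆ Y → u ∉ Y → PSDStep G X u → PSDStep G Y u
  psdStep-mono X⊆Y u∉Y (v , v∈X , _ , vu , only) =
    v , X⊆Y v∈X , u∉Y , vu , λ w vw uw → only w vw (sameComp-antitone X⊆Y uw)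

  fills-zf⇒psd : ∀ {S} → Fills (ZFStep G) S → Fills (PSDStep G) S
  fills-zf⇒psd = fills-transfer (λ _ → Unit.⊤) zf⇒psd (λ _ _ → Unit.tt) Unit.tt
    where
    zf⇒psd : ∀ {S u} → Unit.⊤ → ZFStep G S u → PSDStep G S u
    zf⇒psd _ (v , v∈S , u∉S , vu , only) =
      v , v∈S , u∉S , vu , λ w vw uw → only w vw (sameComp⇒∉ uw)

  fills-zf-drop : ∀ {Z u v} → u ∈ Z → Adj G u v → (∀ w → Adj G u w → w ∈ Z) →
                  Fills (ZFStep G) Z → Fills (ZFStep G) (Z - v)
  fills-zf-drop {Z} {u} {v} u∈Z uv N[u]⊆Z fz =
    force v (u , x∈p∧x≢y⇒x∈p-y u∈Z (adj⇒≢ uv) , v∉Z-v , uv , only)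
      (fills-mono zfStep-mono Z⊆Z-v∪⁅v⁆ fz)
    where
    v∉Z-v : v ∉ Z - v
    v∉Z-v v∈ = x∈p─q⇒x∉q Z ⁅ v ⁆ v∈ (x∈⁅x⁆ v)

    only : ∀ w → Adj G u w → w ∉ Z - v → w ≡ v
    only w uw w∉ with w ≟ᶠ v
    ... | yes w≡v = w≡v
    ... | no w≢v  = ⊥-elim (w∉ (x∈p∧x≢y⇒x∈p-y (N[u]⊆Z w uw) w≢v))

    Z⊆Z-v∪⁅v⁆ : Z ⊆ (Z - v) ∪ ⁅ v ⁆
    Z⊆Z-v∪⁅v⁆ = subst (Z ⊆_) (∪-comm ⁅ v ⁆ (Z - v)) (p⊆⁅x⁆∪p-x Z v)

  clique-filled-after-step : ∀ {C S u v} → IsClique C → v ∈ S → C v →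
                             (∀ w → Adj G v w → w ∉ S → w ≡ u) →
                             ∀ x → C x → x ∈ S ∪ ⁅ u ⁆
  clique-filled-after-step {S = S} {u} {v} clique v∈S Cv only x Cx with x ∈? S
  ... | yes x∈S = p⊆p∪q ⁅ u ⁆ x∈S
  ... | no x∉S with v ≟ᶠ x
  ...   | yes refl = ⊥-elim (x∉S v∈S)
  ...   | no v≢x   = subst (_∈ S ∪ ⁅ u ⁆) (≡-sym (only x (clique v x Cv Cx v≢x) x∉S)) (x∈p∪⁅x⁆ S u)

  module Cobipartition (P : Subset n) (cliqueP : IsClique (_∈ P)) (cliqueQ : IsClique (_∉ P)) where

    CrossingEdge : Subset n → Set
    CrossingEdge T = ∃[ p ] ∃[ q ] (p ∈ P × q ∉ P × p ∉ T × q ∉ T × Adj G p q)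

    crossingEdge? : ∀ T → Dec (CrossingEdge T)
    crossingEdge? T = any? λ p → any? λ q →
      p ∈? P ×-dec ¬? (q ∈? P) ×-dec ¬? (p ∈? T) ×-dec ¬? (q ∈? T) ×-dec adj G p q Bool.≟ true

    -- Certificates that G − T is connected; unlike connectedness of G − T in
    -- general, they survive zero forcing steps.
    data Connected (T : Subset n) : Set where
      P-filled : (∀ x → x ∈ P → x ∈ T) → Connected T
      Q-filled : (∀ x → x ∉ P → x ∈ T) → Connected T
      crossing : CrossingEdge T → Connected T

    connected⇒sameComp : ∀ {T x y} → Connected T → x ∉ T → y ∉ T → SameComp G T x y
    connected⇒sameComp (P-filled all) x∉T y∉T =
      clique-sameComp cliqueQ (x∉T ∘ all _) (y∉T ∘ all _) x∉T y∉T
    connected⇒sameComp {T} (Q-filled all) x∉T y∉T =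
      clique-sameComp cliqueP (unfilled⇒∈P x∉T) (unfilled⇒∈P y∉T) x∉T y∉T
      where
      unfilled⇒∈P : ∀ {z} → z ∉ T → z ∈ P
      unfilled⇒∈P {z} z∉T with z ∈? P
      ... | yes z∈P = z∈P
      ... | no z∉P  = ⊥-elim (z∉T (all z z∉P))
    connected⇒sameComp {x = x} {y} (crossing (p , q , p∈P , q∉P , p∉T , q∉T , pq)) x∉T y∉T
      with x ∈? P | y ∈? P
    ... | yes x∈P | yes y∈P = clique-sameComp cliqueP x∈P y∈P x∉T y∉T
    ... | yes x∈P | no y∉P  = sameComp-trans (clique-sameComp cliqueP x∈P p∈P x∉T p∉T)
                                (step p∉T pq (clique-sameComp cliqueQ q∉P y∉P q∉T y∉T))
    ... | no x∉P  | yes y∈P = sameComp-trans (clique-sameComp cliqueQ x∉P q∉P x∉T q∉T)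
                                (step q∉T (adj-sym pq) (clique-sameComp cliqueP p∈P y∈P p∉T y∉T))
    ... | no x∉P  | no y∉P  = clique-sameComp cliqueQ x∉P y∉P x∉T y∉T

    connected-step : ∀ {T u v} → v ∈ T → (∀ w → Adj G v w → w ∉ T → w ≡ u) →
                     Connected T → Connected (T ∪ ⁅ u ⁆)
    connected-step _ _ (P-filled all) = P-filled (λ x → p⊆p∪q _ ∘ all x)
    connected-step _ _ (Q-filled all) = Q-filled (λ x → p⊆p∪q _ ∘ all x)
    connected-step {u = u} {v} v∈T only (crossing (p , q , p∈P , q∉P , p∉T , q∉T , pq))
      with u ≟ᶠ p | u ≟ᶠ q
    ... | no u≢p | no u≢q =
      crossing (p , q , p∈P , q∉P ,
                x∉p∧x≢y⇒x∉p∪⁅y⁆ p∉T (≢-sym u≢p) , x∉p∧x≢y⇒x∉p∪⁅y⁆ q∉T (≢-sym u≢q) , pq)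
    -- u is an endpoint of the crossing edge; v sees every unfilled vertex of
    -- its own clique, so that clique becomes filled.
    ... | _ | _ with v ∈? P
    ...   | yes v∈P = P-filled (clique-filled-after-step cliqueP v∈T v∈P only)
    ...   | no v∉P  = Q-filled (clique-filled-after-step cliqueQ v∈T v∉P only)

    fills-psd⇒zf : ∀ {T} → Connected T → Fills (PSDStep G) T → Fills (ZFStep G) T
    fills-psd⇒zf = fills-transfer Connected psd⇒zf
      (λ c (_ , v∈S , _ , _ , only) → connected-step v∈S only c)
      where
      psd⇒zf : ∀ {S u} → Connected S → PSDStep G S u → ZFStep G S u
      psd⇒zf c (v , v∈S , u∉S , vu , only) =
        v , v∈S , u∉S , vu , λ w vw w∉S → only w vw (connected⇒sameComp c u∉S w∉S)

    record Covers (T Z : Subset n) : Set where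
      field
        self∈ : ∀ {a} → a ∈ P → a ∉ T → a ∈ Z
        nbr∈  : ∀ {a x} → a ∈ P → a ∉ T → Adj G a x → x ∈ Z

    open Covers

    covers-init : ∀ {S} → ¬ CrossingEdge S → Covers S (S ∪ P)
    covers-init {S} no-crossing = record
      { self∈ = λ a∈P _ → q⊆p∪q S P a∈P
      ; nbr∈  = nbr∈₀
      }
      where
      nbr∈₀ : ∀ {a x} → a ∈ P → a ∉ S → Adj G a x → x ∈ S ∪ P
      nbr∈₀ {a} {x} a∈P a∉S ax with x ∈? S | x ∈? P
      ... | yes x∈S | _       = p⊆p∪q P x∈S
      ... | no _    | yes x∈P = q⊆p∪q S P x∈P
      ... | no x∉S  | no x∉P  = ⊥-elim (no-crossing (a , x , a∈P , x∉P , a∉S , x∉S , ax))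

    covers-antitone : ∀ {T T′ Z} → T ⊆ T′ → Covers T Z → Covers T′ Z
    covers-antitone T⊆T′ cov = record
      { self∈ = λ a∈P a∉T′ → self∈ cov a∈P (a∉T′ ∘ T⊆T′)
      ; nbr∈  = λ a∈P a∉T′ → nbr∈ cov a∈P (a∉T′ ∘ T⊆T′)
      }

    covers-force : ∀ {T Z u v} → u ∈ P → v ∈ T → u ∉ T →
                   (∀ w → Adj G v w → SameComp G T u w → w ≡ u) →
                   Covers T Z → Covers (T ∪ ⁅ u ⁆) (Z - v)
    covers-force {T} {Z} {u} {v} u∈P v∈T u∉T only cov = record
      { self∈ = λ a∈P a∉T′ → x∈p∧x≢y⇒x∈p-y (self∈ cov a∈P (unfilled a∉T′)) λ { refl → unfilled a∉T′ v∈T }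
      ; nbr∈  = λ a∈P a∉T′ ax → x∈p∧x≢y⇒x∈p-y (nbr∈ cov a∈P (unfilled a∉T′) ax) (≢v a∈P a∉T′ ax)
      }
      where
      unfilled : ∀ {a} → a ∉ T ∪ ⁅ u ⁆ → a ∉ T
      unfilled = x∉p∪q⇒x∉p ⁅ u ⁆

      ≢v : ∀ {a x} → a ∈ P → a ∉ T ∪ ⁅ u ⁆ → Adj G a x → x ≢ v
      ≢v {a} a∈P a∉T′ av refl
        with only a (adj-sym av) (clique-sameComp cliqueP u∈P a∈P u∉T (unfilled a∉T′))
      ... | refl = a∉T′ (x∈p∪⁅x⁆ T a)

    simulate : ∀ {T Z} → Fills (PSDStep G) T → Covers T Z → Fills (ZFStep G) Z →
               ∃[ Z′ ] (Fills (ZFStep G) Z′ × ∣ Z′ ∣ + ∣ P ─ T ∣ ≤ ∣ Z ∣)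
    simulate {T} {Z} (done all) _ fz =
      Z , fz , ≤-reflexive (trans (cong (∣ Z ∣ +_) (∀x∈q⇒∣p─q∣≡0 P T all)) (+-identityʳ ∣ Z ∣))
    simulate {T} {Z} (force u (v , v∈T , u∉T , vu , only) rest) cov fz with u ∈? P
    ... | no u∉P =
      let Z′ , fz′ , size = simulate rest (covers-antitone (p⊆p∪q ⁅ u ⁆) cov) fz
      in  Z′ , fz′ , ≤-trans (+-monoʳ-≤ ∣ Z′ ∣ (p⊆q⇒∣p∣≤∣q∣ (p─q⊆p─q∪⁅x⁆ T u∉P))) size
    -- u forces v back from Z - v, so filling u is paid for by dropping v.
    ... | yes u∈P =
      let Z′ , fz′ , size = simulate rest (covers-force u∈P v∈T u∉T only cov)
                              (fills-zf-drop (self∈ cov u∈P u∉T) (adj-sym vu) (λ _ → nbr∈ cov u∈P u∉T) fz)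
      in  Z′ , fz′ , (begin
            ∣ Z′ ∣ + ∣ P ─ T ∣                    ≤⟨ +-monoʳ-≤ ∣ Z′ ∣ (∣p─q∣≤1+∣p─q∪⁅x⁆∣ P T u) ⟩
            ∣ Z′ ∣ + suc ∣ P ─ (T ∪ ⁅ u ⁆) ∣      ≡⟨ +-suc ∣ Z′ ∣ _ ⟩
            suc (∣ Z′ ∣ + ∣ P ─ (T ∪ ⁅ u ⁆) ∣)    ≤⟨ s≤s size ⟩
            suc ∣ Z - v ∣                        ≤⟨ x∈p⇒∣p-x∣<∣p∣ (nbr∈ cov u∈P u∉T (adj-sym vu)) ⟩
            ∣ Z ∣                                ∎)
      where open ≤-Reasoning

    psd-forcing⇒zero-forcing : ∀ {S} → Fills (PSDStep G) S → ∃[ Z ] (Fills (ZFStep G) Z × ∣ Z ∣ ≤ ∣ S ∣)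
    psd-forcing⇒zero-forcing {S} fs with crossingEdge? S
    ... | yes crossing-edge = S , fills-psd⇒zf (crossing crossing-edge) fs , ≤-refl
    ... | no no-crossing =
      let Z , fz , size = simulate fs (covers-init no-crossing) fz₀
      in  Z , fz , +-cancelʳ-≤ (∣ P ─ S ∣) (∣ Z ∣) (∣ S ∣) (≤-trans size (∣p∪q∣≤∣p∣+∣q─p∣ S P))
      where
      fz₀ : Fills (ZFStep G) (S ∪ P)
      fz₀ = fills-psd⇒zf (P-filled (λ _ → q⊆p∪q S P)) (fills-mono psdStep-mono (p⊆p∪q P) fs)

theorem4p15 : ∀ {n} (G : Graph n) → Cobipartite G →
    ∀ k m → IsZ G k → IsZ₊ G m → k ≡ m
theorem4p15 G (P , cliqueP , cliqueQ) _ _ ((Z , fz , refl) , Z-minimal) ((S , fs , refl) , Z₊-minimal)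
  with Cobipartition.psd-forcing⇒zero-forcing G P cliqueP cliqueQ fs
... | Z′ , fz′ , Z′≤S =
  ≤-antisym (≤-trans (Z-minimal Z′ fz′) Z′≤S) (Z₊-minimal Z (fills-zf⇒psd G fz))
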